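{- Let $M,N$ be $\lambda\mu$-terms with $M\to_{\mathrm{base}}N$. Then: (1) for every $s\in\mathcal T(M)$ there is a sum $\mathcal T'\subseteq\mathcal T(N)$ with $s\twoheadrightarrow_r\mathcal T'$; (2) for every $s'\in\mathcal T(N)$ there are $s\in\mathcal T(M)$ and a sum $\mathcal T'\subseteq\mathcal T(N)$ such that $s\twoheadrightarrow_r s'+\mathcal T'$. Furthermore, (1) and (2) also hold whenever $M\to N$.
   Context: Fix disjoint countably infinite sets of variables and names. $\lambda\mu$-terms: $M::=x\mid\lambda x.M\mid MM\mid\mu\alpha.{}_\beta|M|$, up to renaming of bound variables and names. Named application $(M)_\alpha N$: - $(x)_\alpha N=x$, $(\lambda x.M)_\alpha N=\lambda x.(M)_\alpha N$, $(MP)_\alpha N=((M)_\alpha N)((P)_\alpha N)$. - $(\mu\beta.{}_\gamma|M|)_\alpha N=\mu\beta.{}_\gamma|(M)_\alpha N|$ ($\gamma\ne\alpha$), and $(\mu\beta.{}_\alpha|M|)_\alpha N=\mu\beta.{}_\alpha|((M)_\alpha N)N|$. - On named terms: $({}_\gamma|M|)_\alpha N={}_\gamma|(M)_\alpha N|$ ($\gamma\ne\alpha$), and $({}_\alpha|M|)_\alpha N={}_\alpha|((M)_\alpha N)N|$. Reduction on $\lambda\mu$-terms. - $\to_{\mathrm{base}}$ is the union of the three rules $(\lambda x.M)N\to M\{N/x\}$, $(\mu\alpha.{}_\beta|M|)N\to\mu\alpha.({}_\beta|M|)_\alpha N$, and $\mu\gamma.{}_\alpha|\mu\beta.{}_\eta|M||\to\mu\gamma.({}_\eta|M|)\{\alpha/\beta\}$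 ($\{\alpha/\beta\}$ renames free $\beta$ into $\alpha$). - $\to$ is its closure under single-hole contexts. Resource terms and sums. - Resource terms: $t::=x\mid\lambda x.t\mid t[t_1,\dots,t_n]\mid\mu\alpha.{}_\beta|t|$, with bags finite multisets; $1$ is the empty bag and $*$ is union. - Sums are finite sets with idempotent $+$ and empty sum $0$; constructors extend multilinearly, and $0$ annihilates. - A weak composition (w.c.) of a bag $B$ is a tuple of possibly empty bags whose union is $B$. Linear substitution $t\langle B/x\rangle$: - $x\langle[v]/x\rangle=v$, and $x\langle B/x\rangle=0$ otherwise. - For $y\ne x$: $y\langle1/x\rangle=y$, and $y\langle B/x\rangle=0$ if $B\ne1$. - It commutes with $\lambda y$ and with $\mu\alpha.{}_\beta|\cdot|$. - $(t[v_1..v_n])\langle B/x\rangle=\sum_{(B_0..B_n)\text{ w.c.}}t\langle B_0/x\rangle[v_i\langle B_i/x\rangle]_i$. Linear named application $\langle t\rangle_\alpha B$: - $\langle x\rangle_\alpha1=x$, and $\langle x\rangle_\alpha B=0$ if $B\ne1$. - It commutes with $\lambda y$ and with $\mu\gamma$. - $\langle{}_\eta|t|\rangle_\alpha B={}_\eta|\langle t\rangle_\alpha B|$ ($\eta\ne\alpha$), and $\langle{}_\alpha|t|\rangle_\alpha B=\sum_{(B_1,B_2)\text{ w.c.}}{}_\alpha|(\langle t\rangle_\alpha B_1)B_2|$. - $\langle t[v_1..v_n]\rangle_\alpha B=\sum_{(B_0..B_n)}(\langle t\rangle_\alpha B_0)[\langle v_i\rangle_\alpha B_i]_i$. Resource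 reduction. $\to_r$ is the closure under single-hole resource contexts of $(\lambda x.t)B\to t\langle B/x\rangle$, $(\mu\alpha.{}_\beta|t|)B\to\mu\alpha.\langle{}_\beta|t|\rangle_\alpha B$, and $\mu\gamma.{}_\alpha|\mu\beta.{}_\eta|t||\to\mu\gamma.({}_\eta|t|)\{\alpha/\beta\}$. It is extended to sums by $t+\mathcal S\to_r\mathcal T+\mathcal S$ if $t\to_r\mathcal T$ and $t\notin\mathcal S$; $\twoheadrightarrow_r$ is its reflexive–transitive closure. Taylor expansion. - $\mathcal T(x)=\{x\}$, $\mathcal T(\lambda x.M)=\{\lambda x.t\mid t\in\mathcal T(M)\}$, $\mathcal T(\mu\alpha.{}_\beta|M|)=\{\mu\alpha.{}_\beta|t|\mid t\in\mathcal T(M)\}$. - $\mathcal T(MN)=\{t[u_1..u_n]\mid t\in\mathcal T(M),n\ge0,u_i\in\mathcal T(N)\}$. - A sum $\mathcal T'\subseteq\mathcal T(N)$ means all its terms lie in $\mathcal T(N)$. -}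

module Defs where

open import Data.Nat using (ℕ; zero; suc; _≡ᵇ_; _<ᵇ_; pred)
open import Data.Bool using (Bool; true; false; if_then_else_)
open import Data.List using (List; []; _∷_; [_]; _++_; map; concatMap; length; replicate; upTo)
open import Data.List.Relation.Unary.All using (All)
open import Data.List.Relation.Unary.Any using (Any)
open import Data.Product using (Σ; _×_; _,_; ∃)
open import Relation.Nullary using (¬_)

-- Conventions: terms up to α-renaming are represented with de Bruijn
-- indices, in two separate namespaces: variables (bound by lam) and
-- names (bound by mu).  `mu β M` stands for  μα.{}_β|M|  where the
-- binder α is name index 0 and β is a name index in the scope that
-- already includes α (so β may be α itself, i.e. β = 0).

data Tm : Set where
  var : ℕ → Tm
  lam : Tm → Tm
  app : Tm → Tm → Tm
  mu  : ℕ → Tm → Tm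

ext : (ℕ → ℕ) → ℕ → ℕ
ext ρ zero    = zero
ext ρ (suc k) = suc (ρ k)

renV : (ℕ → ℕ) → Tm → Tm
renV ρ (var x)   = var (ρ x)
renV ρ (lam M)   = lam (renV (ext ρ) M)
renV ρ (app M N) = app (renV ρ M) (renV ρ N)
renV ρ (mu β M)  = mu β (renV ρ M)

renN : (ℕ → ℕ) → Tm → Tm
renN ρ (var x)   = var x
renN ρ (lam M)   = lam (renN ρ M)
renN ρ (app M N) = app (renN ρ M) (renN ρ N)
renN ρ (mu β M)  = mu (ext ρ β) (renN (ext ρ) M)

exts : (ℕ → Tm) → ℕ → Tm
exts σ zero    = var zero
exts σ (suc k) = renV suc (σ k)

sub : (ℕ → Tm) → Tm → Tm
sub σ (var x)   = σ x
sub σ (lam M)   = lam (sub (exts σ) M)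
sub σ (app M N) = app (sub σ M) (sub σ N)
sub σ (mu β M)  = mu β (sub (λ k → renN suc (σ k)) M)

-- M{N/x} where x is the variable bound by the enclosing (removed) λ
sub0 : Tm → ℕ → Tm
sub0 N zero    = N
sub0 N (suc k) = var k

mutual
  napp : Tm → ℕ → Tm → Tm
  napp (var x)   α N = var x
  napp (lam M)   α N = lam (napp M α (renV suc N))
  napp (app M P) α N = app (napp M α N) (napp P α N)
  napp (mu γ M)  α N = mu γ (nappNamed γ M (suc α) (renN suc N))

  -- ({}_γ|M|)_α N, returning the body of the resulting named term
  -- (the name γ is unchanged)
  nappNamed : ℕ → Tm → ℕ → Tm → Tm
  nappNamed γ M α N = if γ ≡ᵇ α then app (napp M α N) N else napp M α N

-- renaming {α/β} for the rule μγ.α|μβ.η|M|| → μγ.(η|M|){α/β}: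
-- inside, name 0 is β (replaced by α = a) and the others are lowered.
ρren : ℕ → ℕ → ℕ
ρren a zero    = a
ρren a (suc k) = k

data _→b_ : Tm → Tm → Set where
  β-rule : ∀ M N → app (lam M) N →b sub (sub0 N) M
  μ-rule : ∀ β M N →
           app (mu β M) N →b mu β (nappNamed β M zero (renN suc N))
  ρ-rule : ∀ a e M → mu a (mu e M) →b mu (ρren a e) (renN (ρren a) M)

data _⟶_ : Tm → Tm → Set where
  base : ∀ {M N} → M →b N → M ⟶ N
  ctx-lam : ∀ {M N} → M ⟶ N → lam M ⟶ lam N
  ctx-appL : ∀ {M N} P → M ⟶ N → app M P ⟶ app N P
  ctx-appR : ∀ {M N} P → M ⟶ N → app P M ⟶ app P N
  ctx-mu : ∀ {M N} β → M ⟶ N → mu β M ⟶ mu β N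

-- Resource terms; a bag is a list, read up to permutation (see _≈_)

data RTm : Set where
  rvar : ℕ → RTm
  rlam : RTm → RTm
  rapp : RTm → List RTm → RTm
  rmu  : ℕ → RTm → RTm

Bag : Set
Bag = List RTm

-- Finite sums: lists read as finite sets (idempotent +, 0 = []),
-- up to the equivalence _≃_ below.
Sum : Set
Sum = List RTm

mutual
  renVr : (ℕ → ℕ) → RTm → RTm
  renVr ρ (rvar x)    = rvar (ρ x)
  renVr ρ (rlam t)    = rlam (renVr (ext ρ) t)
  renVr ρ (rapp t vs) = rapp (renVr ρ t) (renVrs ρ vs)
  renVr ρ (rmu β t)   = rmu β (renVr ρ t)

  renVrs : (ℕ → ℕ) → Bag → Bag
  renVrs ρ []       = []
  renVrs ρ (v ∷ vs) = renVr ρ v ∷ renVrs ρ vs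

mutual
  renNr : (ℕ → ℕ) → RTm → RTm
  renNr ρ (rvar x)    = rvar x
  renNr ρ (rlam t)    = rlam (renNr ρ t)
  renNr ρ (rapp t vs) = rapp (renNr ρ t) (renNrs ρ vs)
  renNr ρ (rmu β t)   = rmu (ext ρ β) (renNr (ext ρ) t)

  renNrs : (ℕ → ℕ) → Bag → Bag
  renNrs ρ []       = []
  renNrs ρ (v ∷ vs) = renNr ρ v ∷ renNrs ρ vs

mutual
  data _≈_ : RTm → RTm → Set where
    ≈var : ∀ x → rvar x ≈ rvar x
    ≈lam : ∀ {t u} → t ≈ u → rlam t ≈ rlam u
    ≈app : ∀ {t u B C} → t ≈ u → B ≈ᴮ C → rapp t B ≈ rapp u C
    ≈mu  : ∀ β {t u} → t ≈ u → rmu β t ≈ rmu β u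

  data _≈ᴮ_ : Bag → Bag → Set where
    ≈nil   : [] ≈ᴮ []
    ≈cons  : ∀ {t u B C} → t ≈ u → B ≈ᴮ C → (t ∷ B) ≈ᴮ (u ∷ C)
    ≈swap  : ∀ t u B → (t ∷ u ∷ B) ≈ᴮ (u ∷ t ∷ B)
    ≈trans : ∀ {B C D} → B ≈ᴮ C → C ≈ᴮ D → B ≈ᴮ D

_∈S_ : RTm → Sum → Set
t ∈S S = Any (t ≈_) S

_≃_ : Sum → Sum → Set
S ≃ S' = ∀ t → (t ∈S S → t ∈S S') × (t ∈S S' → t ∈S S)

-- weak compositions of a bag into k (possibly empty) parts: every
-- element of the bag is assigned to one of the k parts.
insertAt : RTm → ℕ → List Bag → List Bag
insertAt t i       []       = []
insertAt t zero    (P ∷ Ps) = (t ∷ P) ∷ Ps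
insertAt t (suc i) (P ∷ Ps) = P ∷ insertAt t i Ps

wc : ℕ → Bag → List (List Bag)
wc k []      = [ replicate k [] ]
wc k (t ∷ B) = concatMap (λ Ps → map (λ i → insertAt t i Ps) (upTo k)) (wc k B)

-- multilinear extension of application: t[u_1..u_n] with t ∈ T, u_i ∈ U_i
choices : List Sum → List Bag
choices []       = [ [] ]
choices (U ∷ Us) = concatMap (λ u → map (u ∷_) (choices Us)) U

prod : Sum → List Sum → Sum
prod T Us = concatMap (λ t → map (rapp t) (choices Us)) T

-- Linear substitution t⟨B/x⟩ (x a de Bruijn variable; the binder of x
-- is removed, so variables above x are lowered)
lsubVar : ℕ → ℕ → Bag → Sum
lsubVar y x B with y ≡ᵇ x | y <ᵇ x | B
... | true  | _     | v ∷ [] = [ v ]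
... | true  | _     | _      = []
... | false | true  | []     = [ rvar y ]
... | false | false | []     = [ rvar (pred y) ]
... | false | _     | _ ∷ _  = []

mutual
  lsub : RTm → ℕ → Bag → Sum
  lsub (rvar y)    x B = lsubVar y x B
  lsub (rlam t)    x B = map rlam (lsub t (suc x) (renVrs suc B))
  lsub (rmu β t)   x B = map (rmu β) (lsub t x (renNrs suc B))
  lsub (rapp t vs) x B = concatMap step (wc (suc (length vs)) B)
    where
    step : List Bag → Sum
    step []        = []
    step (B₀ ∷ Bs) = prod (lsub t x B₀) (lsubs vs x Bs)

  lsubs : List RTm → ℕ → List Bag → List Sum
  lsubs []       x _        = []
  lsubs (v ∷ vs) x []       = []
  lsubs (v ∷ vs) x (B ∷ Bs) = lsub v x B ∷ lsubs vs x Bs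

mutual
  na : RTm → ℕ → Bag → Sum
  na (rvar x)    α []      = [ rvar x ]
  na (rvar x)    α (_ ∷ _) = []
  na (rlam t)    α B = map rlam (na t α (renVrs suc B))
  na (rmu γ t)   α B = naMu γ t (suc α) (renNrs suc B)
  na (rapp t vs) α B = concatMap step (wc (suc (length vs)) B)
    where
    step : List Bag → Sum
    step []        = []
    step (B₀ ∷ Bs) = prod (na t α B₀) (nas vs α Bs)

  nas : List RTm → ℕ → List Bag → List Sum
  nas []       α _        = []
  nas (v ∷ vs) α []       = []
  nas (v ∷ vs) α (B ∷ Bs) = na v α B ∷ nas vs α Bs

  -- μ-wrapped ⟨{}_γ|t|⟩_α B (α and B already in the scope under the μ)
  naMu : ℕ → RTm → ℕ → Bag → Sum
  naMu γ t α B with γ ≡ᵇ α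
  ... | false = map (rmu γ) (na t α B)
  ... | true  = concatMap step (wc 2 B)
    where
    step : List Bag → Sum
    step (B₁ ∷ B₂ ∷ []) = map (λ u → rmu γ (rapp u B₂)) (na t α B₁)
    step _              = []

data _→r_ : RTm → Sum → Set where
  β-r : ∀ t B → rapp (rlam t) B →r lsub t zero B
  μ-r : ∀ β t B → rapp (rmu β t) B →r naMu β t zero (renNrs suc B)
  ρ-r : ∀ a e t → rmu a (rmu e t) →r [ rmu (ρren a e) (renNr (ρren a) t) ]
  lam-r : ∀ {t T} → t →r T → rlam t →r map rlam T
  mu-r  : ∀ {t T} β → t →r T → rmu β t →r map (rmu β) T
  appL-r : ∀ {t T} B → t →r T → rapp t B →r map (λ u → rapp u B) T
  appR-r : ∀ {u U} t B₁ B₂ → u →r U →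
           rapp t (B₁ ++ u ∷ B₂) →r map (λ u' → rapp t (B₁ ++ u' ∷ B₂)) U

data _→Σ_ : Sum → Sum → Set where
  step : ∀ {S S'} t T R → t →r T → ¬ (t ∈S R) →
         S ≃ (t ∷ R) → S' ≃ (T ++ R) → S →Σ S'

data _↠r_ : Sum → Sum → Set where
  ↠refl : ∀ {S S'} → S ≃ S' → S ↠r S'
  ↠step : ∀ {S S' S''} → S →Σ S' → S' ↠r S'' → S ↠r S''

-- Taylor expansion, as a membership predicate  t ∈T M  (t ∈ 𝒯(M))

data _∈T_ : RTm → Tm → Set where
  T-var : ∀ x → rvar x ∈T var x
  T-lam : ∀ {t M} → t ∈T M → rlam t ∈T lam M
  T-mu  : ∀ {t M} β → t ∈T M → rmu β t ∈T mu β M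
  T-app : ∀ {t us M N} → t ∈T M → All (λ u → u ∈T N) us → rapp t us ∈T app M N

_⊆T_ : Sum → Tm → Set
S ⊆T N = All (λ t → t ∈T N) S

Sim₁ : Tm → Tm → Set
Sim₁ M N = ∀ s → s ∈T M → ∃ λ T' → T' ⊆T N × [ s ] ↠r T'

Sim₂ : Tm → Tm → Set
Sim₂ M N = ∀ s' → s' ∈T N →
           ∃ λ s → ∃ λ T' → s ∈T M × T' ⊆T N × [ s ] ↠r (s' ∷ T')

-- Each base rule is simulated on every element of the Taylor expansion by the
-- corresponding resource rule: β by linear substitution, μ by linear named
-- application, ρ by the same renaming.  Linearly substituting (applying) a bag
-- of elements of 𝒯(N) into an element of 𝒯(M) gives a sum inside
-- 𝒯(M{N/x}) (inside 𝒯((M)_α N)), and conversely every element of the latter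
-- occurs in such a sum; this is (1) and (2) for →b.  In argument position
-- the elements of the bag are reduced one at a time and the resulting sums are
-- put together: if every summand reduces into 𝒯(N) so does the sum.  That
-- needs care because sums are sets, and a redex occurring in two summands can
-- only be fired once.

module Submission where

open import Level using (0ℓ)
open import Data.Bool using (Bool; true; false; if_then_else_)
open import Data.Empty using (⊥-elim)
open import Data.Nat using (ℕ; zero; suc; s≤s; _≡ᵇ_; _<ᵇ_; pred)
open import Data.Nat.Properties using (_≟_)
open import Data.List using (List; []; _∷_; [_]; _++_; map; concat; concatMap; filter; length; upTo)
open import Data.List.Properties using (++-assoc; map-++; ++-identityʳ)
open import Data.List.Relation.Unary.All as All using (All; []; _∷_)
import Data.List.Relation.Unary.All.Properties as Allₚ
open import Data.List.Relation.Unary.Any as Any using (Any; here; there; any?)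
import Data.List.Relation.Unary.Any.Properties as Anyₚ
open import Data.List.Relation.Binary.Pointwise.Base using (Pointwise; []; _∷_)
open import Data.List.Membership.Propositional using (_∈_; find; lose)
open import Data.List.Membership.Propositional.Properties using (∈-map⁺; ∈-map⁻; ∈-concatMap⁻; ∈-upTo⁺; ∈-upTo⁻)
import Data.List.Membership.Setoid.Properties as Membershipₚ
open import Data.Product using (∃; ∃₂; _×_; _,_; proj₁; proj₂)
open import Data.Sum using (inj₁; inj₂)
open import Relation.Binary.Bundles using (Setoid)
open import Relation.Binary.PropositionalEquality using (_≡_; refl; sym; cong; subst; subst₂)
open import Relation.Nullary using (¬_; Dec; yes; no; ¬?)

open import Defs

mutual
  ≈-refl : ∀ {t} → t ≈ t
  ≈-refl {rvar x}   = ≈var x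
  ≈-refl {rlam t}   = ≈lam ≈-refl
  ≈-refl {rapp t B} = ≈app ≈-refl ≈ᴮ-refl
  ≈-refl {rmu β t}  = ≈mu β ≈-refl

  ≈ᴮ-refl : ∀ {B} → B ≈ᴮ B
  ≈ᴮ-refl {[]}    = ≈nil
  ≈ᴮ-refl {t ∷ B} = ≈cons ≈-refl ≈ᴮ-refl

mutual
  ≈-sym : ∀ {t u} → t ≈ u → u ≈ t
  ≈-sym (≈var x)   = ≈var x
  ≈-sym (≈lam e)   = ≈lam (≈-sym e)
  ≈-sym (≈app e f) = ≈app (≈-sym e) (≈ᴮ-sym f)
  ≈-sym (≈mu β e)  = ≈mu β (≈-sym e)

  ≈ᴮ-sym : ∀ {B C} → B ≈ᴮ C → C ≈ᴮ B
  ≈ᴮ-sym ≈nil          = ≈nil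
  ≈ᴮ-sym (≈cons e f)   = ≈cons (≈-sym e) (≈ᴮ-sym f)
  ≈ᴮ-sym (≈swap t u B) = ≈swap u t B
  ≈ᴮ-sym (≈trans f g)  = ≈trans (≈ᴮ-sym g) (≈ᴮ-sym f)

≈-trans : ∀ {t u v} → t ≈ u → u ≈ v → t ≈ v
≈-trans (≈var x)   (≈var .x)  = ≈var x
≈-trans (≈lam e)   (≈lam f)   = ≈lam (≈-trans e f)
≈-trans (≈app e g) (≈app f h) = ≈app (≈-trans e f) (≈trans g h)
≈-trans (≈mu β e)  (≈mu .β f) = ≈mu β (≈-trans e f)

≈-setoid : Setoid 0ℓ 0ℓ
≈-setoid = record
  { Carrier       = RTm
  ; _≈_           = _≈_
  ; isEquivalence = record { refl = ≈-refl ; sym = ≈-sym ; trans = ≈-trans }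
  }

∈S-resp-≈ : ∀ {t u S} → t ≈ u → t ∈S S → u ∈S S
∈S-resp-≈ = Membershipₚ.∈-resp-≈ ≈-setoid

data Pick : Bag → RTm → Bag → Set where
  phere  : ∀ {x B} → Pick (x ∷ B) x B
  pthere : ∀ {x y B B'} → Pick B x B' → Pick (y ∷ B) x (y ∷ B')

Pick⇒≈ᴮ : ∀ {C c C'} → Pick C c C' → (c ∷ C') ≈ᴮ C
Pick⇒≈ᴮ phere                           = ≈ᴮ-refl
Pick⇒≈ᴮ (pthere {x = c} {y} {B' = C'} p) = ≈trans (≈swap c y C') (≈cons ≈-refl (Pick⇒≈ᴮ p))

Pick-resp-≈ᴮ : ∀ {B C b B'} → B ≈ᴮ C → Pick B b B' →
               ∃₂ λ c C' → Pick C c C' × b ≈ c × B' ≈ᴮ C'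
Pick-resp-≈ᴮ (≈cons e f) phere = _ , _ , phere , e , f
Pick-resp-≈ᴮ (≈cons {u = u} e f) (pthere p) with Pick-resp-≈ᴮ f p
... | c , C' , p' , bc , f' = c , u ∷ C' , pthere p' , bc , ≈cons e f'
Pick-resp-≈ᴮ (≈swap t u B) phere          = t , u ∷ B , pthere phere , ≈-refl , ≈ᴮ-refl
Pick-resp-≈ᴮ (≈swap t u B) (pthere phere) = u , t ∷ B , phere , ≈-refl , ≈ᴮ-refl
Pick-resp-≈ᴮ (≈swap t u B) (pthere (pthere {B' = B'} p)) =
  _ , u ∷ t ∷ B' , pthere (pthere p) , ≈-refl , ≈swap t u B'
Pick-resp-≈ᴮ (≈trans f g) p with Pick-resp-≈ᴮ f p
... | _ , _ , p' , bc , f' with Pick-resp-≈ᴮ g p'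
... | d , D' , p'' , cd , g' = d , D' , p'' , ≈-trans bc cd , ≈trans f' g'

∷-cancelˡ-≈ᴮ : ∀ {x y B C} → (x ∷ B) ≈ᴮ (y ∷ C) → x ≈ y → B ≈ᴮ C
∷-cancelˡ-≈ᴮ e x≈y with Pick-resp-≈ᴮ e phere
... | _ , _ , phere , _ , f = f
... | _ , _ , pthere p , x≈c , f =
  ≈trans f (≈trans (≈cons (≈-trans (≈-sym x≈y) x≈c) ≈ᴮ-refl) (Pick⇒≈ᴮ p))

Pick-cancel : ∀ {B C x y B' C'} → B ≈ᴮ C → Pick B x B' → Pick C y C' → x ≈ y → B' ≈ᴮ C'
Pick-cancel e p q = ∷-cancelˡ-≈ᴮ (≈trans (Pick⇒≈ᴮ p) (≈trans e (≈ᴮ-sym (Pick⇒≈ᴮ q))))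

Pick-middle : ∀ vs {w} us → Pick (vs ++ w ∷ us) w (vs ++ us)
Pick-middle []       us = phere
Pick-middle (v ∷ vs) us = pthere (Pick-middle vs us)

∷-cancelʳ-≈ᴮ : ∀ {w w'} L → (w ∷ L) ≈ᴮ (w' ∷ L) → w ≈ w'
∷-cancelʳ-≈ᴮ [] e with Pick-resp-≈ᴮ e phere
... | _ , _ , phere , w≈w' , _ = w≈w'
... | _ , _ , pthere () , _
∷-cancelʳ-≈ᴮ (l ∷ L) e = ∷-cancelʳ-≈ᴮ L (Pick-cancel e (pthere phere) (pthere phere) ≈-refl)

middle-cancel-≈ᴮ : ∀ {w w'} vs us → (vs ++ w ∷ us) ≈ᴮ (vs ++ w' ∷ us) → w ≈ w'
middle-cancel-≈ᴮ vs us e = ∷-cancelʳ-≈ᴮ (vs ++ us)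
  (≈trans (Pick⇒≈ᴮ (Pick-middle vs us)) (≈trans e (≈ᴮ-sym (Pick⇒≈ᴮ (Pick-middle vs us)))))

middle-cong-≈ᴮ : ∀ {w w'} vs us → w ≈ w' → (vs ++ w ∷ us) ≈ᴮ (vs ++ w' ∷ us)
middle-cong-≈ᴮ []       us e = ≈cons e ≈ᴮ-refl
middle-cong-≈ᴮ (v ∷ vs) us e = ≈cons ≈-refl (middle-cong-≈ᴮ vs us e)

[]≉ᴮ∷ : ∀ {c C} → ¬ ([] ≈ᴮ (c ∷ C))
[]≉ᴮ∷ e with Pick-resp-≈ᴮ (≈ᴮ-sym e) phere
... | _ , _ , () , _

mutual
  _≈?_ : (t u : RTm) → Dec (t ≈ u)
  rvar x ≈? rvar y with x ≟ y
  ... | yes refl = yes (≈var x)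
  ... | no x≢y   = no λ { (≈var _) → x≢y refl }
  rlam t ≈? rlam u with t ≈? u
  ... | yes e = yes (≈lam e)
  ... | no ¬e = no λ { (≈lam e) → ¬e e }
  rapp t B ≈? rapp u C with t ≈? u | B ≈ᴮ? C
  ... | yes e | yes f = yes (≈app e f)
  ... | no ¬e | _     = no λ { (≈app e _) → ¬e e }
  ... | _     | no ¬f = no λ { (≈app _ f) → ¬f f }
  rmu β t ≈? rmu γ u with β ≟ γ | t ≈? u
  ... | yes refl | yes e = yes (≈mu β e)
  ... | no β≢γ   | _     = no λ { (≈mu _ _) → β≢γ refl }
  ... | _        | no ¬e = no λ { (≈mu _ e) → ¬e e }
  rvar _   ≈? rlam _   = no λ ()
  rvar _   ≈? rapp _ _ = no λ ()
  rvar _   ≈? rmu _ _  = no λ ()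
  rlam _   ≈? rvar _   = no λ ()
  rlam _   ≈? rapp _ _ = no λ ()
  rlam _   ≈? rmu _ _  = no λ ()
  rapp _ _ ≈? rvar _   = no λ ()
  rapp _ _ ≈? rlam _   = no λ ()
  rapp _ _ ≈? rmu _ _  = no λ ()
  rmu _ _  ≈? rvar _   = no λ ()
  rmu _ _  ≈? rlam _   = no λ ()
  rmu _ _  ≈? rapp _ _ = no λ ()

  _≈ᴮ?_ : (B C : Bag) → Dec (B ≈ᴮ C)
  []      ≈ᴮ? []      = yes ≈nil
  []      ≈ᴮ? (_ ∷ _) = no []≉ᴮ∷
  (b ∷ B) ≈ᴮ? C with pick? b C
  ... | no ∄c = no λ e → let c , C' , p , b≈c , _ = Pick-resp-≈ᴮ e phere in ∄c (c , C' , p , b≈c)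
  ... | yes (c , C' , p , b≈c) with B ≈ᴮ? C'
  ...   | yes B≈C' = yes (≈trans (≈cons b≈c B≈C') (Pick⇒≈ᴮ p))
  ...   | no B≉C'  = no λ e →
            let _ , _ , p₀ , b≈c₀ , B≈C₀ = Pick-resp-≈ᴮ e phere
            in B≉C' (≈trans B≈C₀ (Pick-cancel ≈ᴮ-refl p₀ p (≈-trans (≈-sym b≈c₀) b≈c)))

  pick? : (b : RTm) (C : Bag) → Dec (∃₂ λ c C' → Pick C c C' × b ≈ c)
  pick? b [] = no λ { (_ , _ , () , _) }
  pick? b (c ∷ C) with b ≈? c | pick? b C
  ... | yes b≈c | _ = yes (c , C , phere , b≈c)
  ... | no _    | yes (c' , C' , p , b≈c') = yes (c' , c ∷ C' , pthere p , b≈c')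
  ... | no b≉c  | no ∄c' = no λ
    { (_ , _ , phere , b≈c)    → b≉c b≈c
    ; (_ , _ , pthere p , b≈c') → ∄c' (_ , _ , p , b≈c') }

∈⇒∈S : ∀ {x S} → x ∈ S → x ∈S S
∈⇒∈S = Any.map λ { refl → ≈-refl }

_⊆S_ : Sum → Sum → Set
S ⊆S T = ∀ {x} → x ∈S S → x ∈S T

⊆S-antisym : ∀ {S T} → S ⊆S T → T ⊆S S → S ≃ T
⊆S-antisym S⊆T T⊆S _ = S⊆T , T⊆S

≃⇒⊆S : ∀ {S T} → S ≃ T → S ⊆S T
≃⇒⊆S e = proj₁ (e _)

≃⇒⊇S : ∀ {S T} → S ≃ T → T ⊆S S
≃⇒⊇S e = proj₂ (e _)

≃-refl : ∀ {S} → S ≃ S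
≃-refl = ⊆S-antisym (λ m → m) (λ m → m)

≃-trans : ∀ {S T U} → S ≃ T → T ≃ U → S ≃ U
≃-trans e f = ⊆S-antisym (λ m → ≃⇒⊆S f (≃⇒⊆S e m)) (λ m → ≃⇒⊇S e (≃⇒⊇S f m))

++⁺-⊆S : ∀ {S S' T T'} → S ⊆S S' → T ⊆S T' → (S ++ T) ⊆S (S' ++ T')
++⁺-⊆S {S} {S'} S⊆S' T⊆T' m with Anyₚ.++⁻ S m
... | inj₁ x∈S = Anyₚ.++⁺ˡ (S⊆S' x∈S)
... | inj₂ x∈T = Anyₚ.++⁺ʳ S' (T⊆T' x∈T)

++-cong-≃ : ∀ {S S' T T'} → S ≃ S' → T ≃ T' → (S ++ T) ≃ (S' ++ T')
++-cong-≃ e f = ⊆S-antisym (++⁺-⊆S (≃⇒⊆S e) (≃⇒⊆S f)) (++⁺-⊆S (≃⇒⊇S e) (≃⇒⊇S f))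

++-exchange-⊆S : ∀ A B C → (A ++ (B ++ C)) ⊆S (B ++ (A ++ C))
++-exchange-⊆S A B C m with Anyₚ.++⁻ A m
... | inj₁ x∈A = Anyₚ.++⁺ʳ B (Anyₚ.++⁺ˡ x∈A)
... | inj₂ x∈BC with Anyₚ.++⁻ B x∈BC
...   | inj₁ x∈B = Anyₚ.++⁺ˡ x∈B
...   | inj₂ x∈C = Anyₚ.++⁺ʳ B (Anyₚ.++⁺ʳ A x∈C)

++-exchange-≃ : ∀ A B C → (A ++ (B ++ C)) ≃ (B ++ (A ++ C))
++-exchange-≃ A B C = ⊆S-antisym (++-exchange-⊆S A B C) (++-exchange-⊆S B A C)

∈S⇒∷-≃ : ∀ {t S} → t ∈S S → S ≃ (t ∷ S)
∈S⇒∷-≃ t∈S = ⊆S-antisym there λ { (here x≈t) → ∈S-resp-≈ (≈-sym x≈t) t∈S ; (there m) → m }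

∈S-map⁺ : ∀ {f} → (∀ {a b} → a ≈ b → f a ≈ f b) → ∀ {x S} → x ∈S S → f x ∈S map f S
∈S-map⁺ f-cong = Membershipₚ.∈-map⁺ ≈-setoid ≈-setoid f-cong

map-mono-⊆S : ∀ {f} → (∀ {a b} → a ≈ b → f a ≈ f b) → ∀ {S T} → S ⊆S T → map f S ⊆S map f T
map-mono-⊆S f-cong {S} S⊆T m =
  let _ , x∈S , y≈fx = Membershipₚ.∈-map⁻ ≈-setoid ≈-setoid {xs = S} m
  in ∈S-resp-≈ (≈-sym y≈fx) (∈S-map⁺ f-cong (S⊆T x∈S))

map-cong-≃ : ∀ {f} → (∀ {a b} → a ≈ b → f a ≈ f b) → ∀ {S T} → S ≃ T → map f S ≃ map f T
map-cong-≃ f-cong e = ⊆S-antisym (map-mono-⊆S f-cong (≃⇒⊆S e)) (map-mono-⊆S f-cong (≃⇒⊇S e))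

∈S-map⁻ : ∀ {f} → (∀ {a b} → f a ≈ f b → a ≈ b) → ∀ {x S} → f x ∈S map f S → x ∈S S
∈S-map⁻ f-inj {S = S} m =
  let y , y∈S , fx≈fy = Membershipₚ.∈-map⁻ ≈-setoid ≈-setoid {xs = S} m
  in ∈S-resp-≈ (≈-sym (f-inj fx≈fy)) y∈S

_∈S?_ : ∀ t S → Dec (t ∈S S)
t ∈S? S = any? (t ≈?_) S

remove : RTm → Sum → Sum
remove t = filter (λ u → ¬? (t ≈? u))

module _ {t : RTm} where
  private
    ≉-resp : ∀ {x y} → x ≈ y → ¬ (t ≈ x) → ¬ (t ≈ y)
    ≉-resp x≈y t≉x t≈y = t≉x (≈-trans t≈y (≈-sym x≈y))

  ∈-remove⁻ : ∀ {x S} → x ∈S remove t S → x ∈S S × ¬ (t ≈ x)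
  ∈-remove⁻ = Membershipₚ.∈-filter⁻ ≈-setoid (λ u → ¬? (t ≈? u)) ≉-resp

  ∈-remove⁺ : ∀ {x S} → x ∈S S → ¬ (t ≈ x) → x ∈S remove t S
  ∈-remove⁺ = Membershipₚ.∈-filter⁺ ≈-setoid (λ u → ¬? (t ≈? u)) ≉-resp

remove-⊆S : ∀ t {S} → remove t S ⊆S S
remove-⊆S t {S} m = proj₁ (∈-remove⁻ {S = S} m)

∉-remove : ∀ t S → ¬ (t ∈S remove t S)
∉-remove t S m = proj₂ (∈-remove⁻ {S = S} m) ≈-refl

∷⁺-⊆S : ∀ {t S T} → S ⊆S T → (t ∷ S) ⊆S (t ∷ T)
∷⁺-⊆S S⊆T (here x≈t) = here x≈t
∷⁺-⊆S S⊆T (there m)  = there (S⊆T m)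

∷-++-remove-≃ : ∀ t R X → (t ∷ (R ++ X)) ≃ (t ∷ (R ++ remove t X))
∷-++-remove-≃ t R X = ⊆S-antisym fw (∷⁺-⊆S (++⁺-⊆S {R} {R} (λ m → m) (remove-⊆S t)))
  where
  fw : (t ∷ (R ++ X)) ⊆S (t ∷ (R ++ remove t X))
  fw (here x≈t) = here x≈t
  fw {x} (there m) with Anyₚ.++⁻ R m | t ≈? x
  ... | inj₁ x∈R | _       = there (Anyₚ.++⁺ˡ x∈R)
  ... | inj₂ _   | yes t≈x = here (≈-sym t≈x)
  ... | inj₂ x∈X | no t≉x  = there (Anyₚ.++⁺ʳ R (∈-remove⁺ x∈X t≉x))

++-remove-≃ : ∀ {t} S X → (∀ {x} → x ∈S X → t ≈ x → x ∈S S) → (S ++ X) ≃ (S ++ remove t X)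
++-remove-≃ {t} S X covered = ⊆S-antisym fw (++⁺-⊆S {S} {S} (λ m → m) (remove-⊆S t))
  where
  fw : (S ++ X) ⊆S (S ++ remove t X)
  fw {x} m with Anyₚ.++⁻ S m | t ≈? x
  ... | inj₁ x∈S | _       = Anyₚ.++⁺ˡ x∈S
  ... | inj₂ x∈X | yes t≈x = Anyₚ.++⁺ˡ (covered x∈X t≈x)
  ... | inj₂ x∈X | no t≉x  = Anyₚ.++⁺ʳ S (∈-remove⁺ x∈X t≉x)

remove-⊆S-rest : ∀ {t R S X} → S ≃ (t ∷ R) → X ⊆S S → remove t X ⊆S R
remove-⊆S-rest {t} {X = X} S≃ X⊆S m with ≃⇒⊆S S≃ (X⊆S (remove-⊆S t m))
... | here x≈t  = ⊥-elim (proj₂ (∈-remove⁻ {S = X} m) (≈-sym x≈t))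
... | there x∈R = x∈R

→r⇒↠r : ∀ {t T} → t →r T → [ t ] ↠r T
→r⇒↠r {t} {T} r = ↠step (step t T [] r (λ ()) ≃-refl (subst (T ≃_) (sym (++-identityʳ T)) ≃-refl)) (↠refl ≃-refl)

↠r-respˡ-≃ : ∀ {S S₀ T} → S ≃ S₀ → S₀ ↠r T → S ↠r T
↠r-respˡ-≃ e (↠refl f)                       = ↠refl (≃-trans e f)
↠r-respˡ-≃ e (↠step (step t T R r t∉R f g) D) = ↠step (step t T R r t∉R (≃-trans e f) g) D

↠r-respʳ-≃ : ∀ {S T T'} → S ↠r T → T ≃ T' → S ↠r T'
↠r-respʳ-≃ (↠refl f)   e = ↠refl (≃-trans f e)
↠r-respʳ-≃ (↠step s D) e = ↠step s (↠r-respʳ-≃ D e)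

↠r-trans : ∀ {S T U} → S ↠r T → T ↠r U → S ↠r U
↠r-trans (↠refl f)   D' = ↠r-respˡ-≃ f D'
↠r-trans (↠step s D) D' = ↠step s (↠r-trans D D')

record Context (f : RTm → RTm) : Set where
  field
    cong-≈      : ∀ {a b} → a ≈ b → f a ≈ f b
    injective-≈ : ∀ {a b} → f a ≈ f b → a ≈ b
    reduce      : ∀ {t T} → t →r T → f t →r map f T
open Context

↠r-map : ∀ {f} → Context f → ∀ {S T} → S ↠r T → map f S ↠r map f T
↠r-map C (↠refl e) = ↠refl (map-cong-≃ (cong-≈ C) e)
↠r-map {f} C (↠step (step t T R r t∉R e g) D) =
  ↠step (step (f t) (map f T) (map f R) (reduce C r) (λ m → t∉R (∈S-map⁻ (injective-≈ C) m))
          (map-cong-≃ (cong-≈ C) e) (subst (_ ≃_) (map-++ f T R) (map-cong-≃ (cong-≈ C) g)))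
        (↠r-map C D)

fire-step : ∀ {t T R S₁ S₂ S₂' X} → t →r T → S₂ ≃ (t ∷ R) → S₂' ≃ (T ++ R) → X ⊆S S₂ →
            ¬ (t ∈S S₁) → t ∈S X → ∃ λ X' → X' ⊆S S₂' × (S₁ ++ X) ↠r (S₁ ++ X')
fire-step {t} {T} {S₁ = S₁} {X = X} r S₂≃ S₂'≃ X⊆S₂ t∉S₁ t∈X =
  T ++ remove t X , (λ m → ≃⇒⊇S S₂'≃ (++⁺-⊆S (λ m → m) (remove-⊆S-rest S₂≃ X⊆S₂) m)) ,
  ↠step (step t T (S₁ ++ remove t X) r t∉ extract (++-exchange-≃ S₁ T (remove t X))) (↠refl ≃-refl)
  where
  t∉ : ¬ (t ∈S (S₁ ++ remove t X))
  t∉ m with Anyₚ.++⁻ S₁ m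
  ... | inj₁ t∈S₁ = t∉S₁ t∈S₁
  ... | inj₂ t∈X' = ∉-remove t X t∈X'
  extract : (S₁ ++ X) ≃ (t ∷ (S₁ ++ remove t X))
  extract = ≃-trans (++-cong-≃ ≃-refl (∈S⇒∷-≃ t∈X))
           (≃-trans (++-exchange-≃ S₁ [ t ] X) (∷-++-remove-≃ t S₁ X))

drop-copies : ∀ {t T R S₁ S₂ S₂' X} → S₂ ≃ (t ∷ R) → S₂' ≃ (T ++ R) → X ⊆S S₂ →
              (∀ {x} → x ∈S X → t ≈ x → x ∈S S₁) → ∃ λ X' → X' ⊆S S₂' × (S₁ ++ X) ↠r (S₁ ++ X')
drop-copies {t} {T} {S₁ = S₁} {X = X} S₂≃ S₂'≃ X⊆S₂ covered =
  remove t X , (λ m → ≃⇒⊇S S₂'≃ (Anyₚ.++⁺ʳ T (remove-⊆S-rest S₂≃ X⊆S₂ m))) ,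
  ↠refl (++-remove-≃ S₁ X covered)

-- Sums are sets: a redex of S₂ may already occur in S₁, and then it cannot
-- be fired in S₁ ++ X; its copies are dropped from X instead.
mirror-step : ∀ {S₂ S₂'} → S₂ →Σ S₂' → ∀ S₁ X → X ⊆S S₂ →
              ∃ λ X' → X' ⊆S S₂' × (S₁ ++ X) ↠r (S₁ ++ X')
mirror-step (step t T R r _ S₂≃ S₂'≃) S₁ X X⊆S₂ with t ∈S? S₁ | t ∈S? X
... | no t∉S₁ | yes t∈X = fire-step r S₂≃ S₂'≃ X⊆S₂ t∉S₁ t∈X
... | yes t∈S₁ | _      = drop-copies S₂≃ S₂'≃ X⊆S₂ (λ _ t≈x → ∈S-resp-≈ t≈x t∈S₁)
... | no _ | no t∉X     = drop-copies S₂≃ S₂'≃ X⊆S₂ (λ x∈X t≈x → ⊥-elim (t∉X (∈S-resp-≈ (≈-sym t≈x) x∈X)))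

step-++ʳ : ∀ {S₁ S₁'} → S₁ →Σ S₁' → ∀ X → ∃ λ X' → X' ⊆S X × (S₁ ++ X) →Σ (S₁' ++ X')
step-++ʳ (step t T R r t∉R S₁≃ S₁'≃) X =
  remove t X , remove-⊆S t ,
  step t T (R ++ remove t X) r t∉ (≃-trans (++-cong-≃ S₁≃ ≃-refl) (∷-++-remove-≃ t R X))
       (subst (_ ≃_) (++-assoc T R (remove t X)) (++-cong-≃ S₁'≃ ≃-refl))
  where
  t∉ : ¬ (t ∈S (R ++ remove t X))
  t∉ m with Anyₚ.++⁻ R m
  ... | inj₁ t∈R  = t∉R t∈R
  ... | inj₂ t∈X' = ∉-remove t X t∈X'

ReducesInto : (RTm → Set) → Sum → Set
ReducesInto G S = ∃ λ T → All G T × S ↠r T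

module _ {G : RTm → Set} (G-resp : ∀ {a b} → a ≈ b → G a → G b) where

  All-⊆S : ∀ {X T} → X ⊆S T → All G T → All G X
  All-⊆S X⊆T A = All.tabulate λ x∈X →
    let _ , y∈T , x≈y = find (X⊆T (∈⇒∈S x∈X))
    in G-resp (≈-sym x≈y) (All.lookup A y∈T)

  reduce-++ʳ : ∀ {S₂ T₂} → S₂ ↠r T₂ → All G T₂ → ∀ S₁ X → All G S₁ → X ⊆S S₂ →
               ∃ λ T → All G T × S₁ ⊆S T × (S₁ ++ X) ↠r T
  reduce-++ʳ (↠refl S₂≃T₂) A₂ S₁ X A₁ X⊆S₂ =
    S₁ ++ X , Allₚ.++⁺ A₁ (All-⊆S (λ m → ≃⇒⊆S S₂≃T₂ (X⊆S₂ m)) A₂) , Anyₚ.++⁺ˡ , ↠refl ≃-refl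
  reduce-++ʳ (↠step s D) A₂ S₁ X A₁ X⊆S₂ with mirror-step s S₁ X X⊆S₂
  ... | X' , X'⊆ , D₁ with reduce-++ʳ D A₂ S₁ X' A₁ X'⊆
  ... | T , A , S₁⊆T , D₂ = T , A , S₁⊆T , ↠r-trans D₁ D₂

  reduce-++ : ∀ {S₁ T₁} → S₁ ↠r T₁ → All G T₁ → ∀ {S₂ T₂} → S₂ ↠r T₂ → All G T₂ →
              ∀ X → X ⊆S S₂ → ∃ λ T → All G T × T₁ ⊆S T × (S₁ ++ X) ↠r T
  reduce-++ {T₁ = T₁} (↠refl S₁≃T₁) A₁ D₂ A₂ X X⊆S₂ with reduce-++ʳ D₂ A₂ T₁ X A₁ X⊆S₂
  ... | T , A , T₁⊆T , D = T , A , T₁⊆T , ↠r-respˡ-≃ (++-cong-≃ S₁≃T₁ ≃-refl) D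
  reduce-++ (↠step s D₁) A₁ D₂ A₂ X X⊆S₂ with step-++ʳ s X
  ... | X' , X'⊆X , s' with reduce-++ D₁ A₁ D₂ A₂ X' (λ m → X⊆S₂ (X'⊆X m))
  ... | T , A , T₁⊆T , D = T , A , T₁⊆T , ↠step s' D

  ReducesInto-++ : ∀ {S₁ S₂} → ReducesInto G S₁ → ReducesInto G S₂ → ReducesInto G (S₁ ++ S₂)
  ReducesInto-++ (_ , A₁ , D₁) (_ , A₂ , D₂) with reduce-++ D₁ A₁ D₂ A₂ _ (λ m → m)
  ... | T , A , _ , D = T , A , D

  ReducesInto-sum : ∀ {S} → All (λ x → ReducesInto G [ x ]) S → ReducesInto G S
  ReducesInto-sum []       = [] , [] , ↠refl ≃-refl
  ReducesInto-sum (r ∷ rs) = ReducesInto-++ r (ReducesInto-sum rs)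

  ReducesInto-↠r : ∀ {S S'} → S ↠r S' → ReducesInto G S' → ReducesInto G S
  ReducesInto-↠r D (T , A , D') = T , A , ↠r-trans D D'

  ↠r-∷-ReducesInto : ∀ {a b T₀ S} → [ a ] ↠r (b ∷ T₀) → All G (b ∷ T₀) → ReducesInto G S →
                     ∃ λ T → All G T × (a ∷ S) ↠r (b ∷ T)
  ↠r-∷-ReducesInto D A (_ , A₂ , D₂) with reduce-++ D A D₂ A₂ _ (λ m → m)
  ... | T , AT , bT₀⊆T , D' = T , AT , ↠r-respʳ-≃ D' (∈S⇒∷-≃ (bT₀⊆T (here ≈-refl)))

mutual
  ∈T-resp-≈ : ∀ {t u M} → t ≈ u → t ∈T M → u ∈T M
  ∈T-resp-≈ (≈var x)   d             = d
  ∈T-resp-≈ (≈lam e)   (T-lam d)     = T-lam (∈T-resp-≈ e d)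
  ∈T-resp-≈ (≈app e f) (T-app d ds)  = T-app (∈T-resp-≈ e d) (All-∈T-resp-≈ᴮ f ds)
  ∈T-resp-≈ (≈mu β e)  (T-mu .β d)   = T-mu β (∈T-resp-≈ e d)

  All-∈T-resp-≈ᴮ : ∀ {B C N} → B ≈ᴮ C → All (_∈T N) B → All (_∈T N) C
  All-∈T-resp-≈ᴮ ≈nil          []            = []
  All-∈T-resp-≈ᴮ (≈cons e f)   (d ∷ ds)      = ∈T-resp-≈ e d ∷ All-∈T-resp-≈ᴮ f ds
  All-∈T-resp-≈ᴮ (≈swap t u B) (d ∷ d' ∷ ds) = d' ∷ d ∷ ds
  All-∈T-resp-≈ᴮ (≈trans f g)  ds            = All-∈T-resp-≈ᴮ g (All-∈T-resp-≈ᴮ f ds)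

mutual
  ∈T-renV : ∀ ρ {t M} → t ∈T M → renVr ρ t ∈T renV ρ M
  ∈T-renV ρ (T-var x)    = T-var (ρ x)
  ∈T-renV ρ (T-lam d)    = T-lam (∈T-renV (ext ρ) d)
  ∈T-renV ρ (T-mu β d)   = T-mu β (∈T-renV ρ d)
  ∈T-renV ρ (T-app d ds) = T-app (∈T-renV ρ d) (All-∈T-renV ρ ds)

  All-∈T-renV : ∀ ρ {us N} → All (_∈T N) us → All (_∈T renV ρ N) (renVrs ρ us)
  All-∈T-renV ρ []       = []
  All-∈T-renV ρ (d ∷ ds) = ∈T-renV ρ d ∷ All-∈T-renV ρ ds

mutual
  ∈T-renN : ∀ ρ {t M} → t ∈T M → renNr ρ t ∈T renN ρ M
  ∈T-renN ρ (T-var x)    = T-var x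
  ∈T-renN ρ (T-lam d)    = T-lam (∈T-renN ρ d)
  ∈T-renN ρ (T-mu β d)   = T-mu (ext ρ β) (∈T-renN (ext ρ) d)
  ∈T-renN ρ (T-app d ds) = T-app (∈T-renN ρ d) (All-∈T-renN ρ ds)

  All-∈T-renN : ∀ ρ {us N} → All (_∈T N) us → All (_∈T renN ρ N) (renNrs ρ us)
  All-∈T-renN ρ []       = []
  All-∈T-renN ρ (d ∷ ds) = ∈T-renN ρ d ∷ All-∈T-renN ρ ds

mutual
  All-∈T-renV⁻ : ∀ ρ N {us} → All (_∈T renV ρ N) us → ∃ λ vs → All (_∈T N) vs × renVrs ρ vs ≡ us
  All-∈T-renV⁻ ρ N []       = [] , [] , refl
  All-∈T-renV⁻ ρ N (d ∷ ds) with ∈T-renV⁻ ρ N d | All-∈T-renV⁻ ρ N ds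
  ... | t , d' , refl | vs , ds' , refl = t ∷ vs , d' ∷ ds' , refl

  ∈T-renV⁻ : ∀ ρ M {s} → s ∈T renV ρ M → ∃ λ t → t ∈T M × renVr ρ t ≡ s
  ∈T-renV⁻ ρ (var x) (T-var _) = rvar x , T-var x , refl
  ∈T-renV⁻ ρ (lam M) (T-lam d) with ∈T-renV⁻ (ext ρ) M d
  ... | t , d' , refl = rlam t , T-lam d' , refl
  ∈T-renV⁻ ρ (app M N) (T-app d ds) with ∈T-renV⁻ ρ M d | All-∈T-renV⁻ ρ N ds
  ... | t , d' , refl | vs , ds' , refl = rapp t vs , T-app d' ds' , refl
  ∈T-renV⁻ ρ (mu β M) (T-mu _ d) with ∈T-renV⁻ ρ M d
  ... | t , d' , refl = rmu β t , T-mu β d' , refl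

mutual
  All-∈T-renN⁻ : ∀ ρ N {us} → All (_∈T renN ρ N) us → ∃ λ vs → All (_∈T N) vs × renNrs ρ vs ≡ us
  All-∈T-renN⁻ ρ N []       = [] , [] , refl
  All-∈T-renN⁻ ρ N (d ∷ ds) with ∈T-renN⁻ ρ N d | All-∈T-renN⁻ ρ N ds
  ... | t , d' , refl | vs , ds' , refl = t ∷ vs , d' ∷ ds' , refl

  ∈T-renN⁻ : ∀ ρ M {s} → s ∈T renN ρ M → ∃ λ t → t ∈T M × renNr ρ t ≡ s
  ∈T-renN⁻ ρ (var x) (T-var _) = rvar x , T-var x , refl
  ∈T-renN⁻ ρ (lam M) (T-lam d) with ∈T-renN⁻ ρ M d
  ... | t , d' , refl = rlam t , T-lam d' , refl
  ∈T-renN⁻ ρ (app M N) (T-app d ds) with ∈T-renN⁻ ρ M d | All-∈T-renN⁻ ρ N ds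
  ... | t , d' , refl | vs , ds' , refl = rapp t vs , T-app d' ds' , refl
  ∈T-renN⁻ ρ (mu β M) (T-mu _ d) with ∈T-renN⁻ (ext ρ) M d
  ... | t , d' , refl = rmu β t , T-mu β d' , refl

Any-concatMap⁺ : ∀ {A B : Set} {P : B → Set} (f : A → List B) {a xs} →
                 a ∈ xs → Any P (f a) → Any P (concatMap f xs)
Any-concatMap⁺ f a∈xs p = Anyₚ.concatMap⁺ f (lose a∈xs p)

module _ {P : RTm → Set} where
  All-insertAt : ∀ {t} i Qs → P t → All (All P) Qs → All (All P) (insertAt t i Qs)
  All-insertAt i       []       p []       = []
  All-insertAt zero    (Q ∷ Qs) p (q ∷ qs) = (p ∷ q) ∷ qs
  All-insertAt (suc i) (Q ∷ Qs) p (q ∷ qs) = q ∷ All-insertAt i Qs p qs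

  wc-All : ∀ k {B} → All P B → All (All (All P)) (wc k B)
  wc-All k []       = Allₚ.replicate⁺ k [] ∷ []
  wc-All k (p ∷ ps) = Allₚ.concat⁺ (Allₚ.map⁺ (All.map (λ {Qs} qs →
    Allₚ.map⁺ (Allₚ.applyUpTo⁺₂ _ k (λ i → All-insertAt i Qs p qs))) (wc-All k ps)))

  choices-All : ∀ {Us} → All (All P) Us → All (All P) (choices Us)
  choices-All []       = [] ∷ []
  choices-All (u ∷ us) = Allₚ.concat⁺ (Allₚ.map⁺ (All.map (λ p → Allₚ.map⁺ (All.map (p ∷_) (choices-All us))) u))

[]∷-∈-wc : ∀ {Qs} k C → Qs ∈ wc k C → ([] ∷ Qs) ∈ wc (suc k) C
[]∷-∈-wc k []      (here refl) = here refl
[]∷-∈-wc k (c ∷ C) m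
  with _ , Qs∈ , m' ← find (∈-concatMap⁻ (λ Ps → map (λ i → insertAt c i Ps) (upTo k)) {xs = wc k C} m)
  with i , i∈ , refl ← ∈-map⁻ _ m'
  = Any-concatMap⁺ _ ([]∷-∈-wc k C Qs∈) (∈-map⁺ _ (∈-upTo⁺ (s≤s (∈-upTo⁻ i∈))))

∷-∈-wc : ∀ {Q Qs c} k C → (Q ∷ Qs) ∈ wc (suc k) C → ((c ∷ Q) ∷ Qs) ∈ wc (suc k) (c ∷ C)
∷-∈-wc k C m = Any-concatMap⁺ _ m (here refl)

++-∈-wc : ∀ {Qs} k Q C → ([] ∷ Qs) ∈ wc (suc k) C → (Q ∷ Qs) ∈ wc (suc k) (Q ++ C)
++-∈-wc k []      C m = m
++-∈-wc k (c ∷ Q) C m = ∷-∈-wc k (Q ++ C) (++-∈-wc k Q C m)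

∈-wc-concat : ∀ Ps → Ps ∈ wc (length Ps) (concat Ps)
∈-wc-concat []       = here refl
∈-wc-concat (P ∷ Ps) = ++-∈-wc (length Ps) P (concat Ps) ([]∷-∈-wc (length Ps) (concat Ps) (∈-wc-concat Ps))

∈-wc-split : ∀ B₀ Bs {n} → length Bs ≡ n → (B₀ ∷ Bs) ∈ wc (suc n) (B₀ ++ concat Bs)
∈-wc-split B₀ Bs refl = ∈-wc-concat (B₀ ∷ Bs)

∈-choices : ∀ {us Us} → Pointwise _∈S_ us Us → ∃ λ c → c ∈ choices Us × us ≈ᴮ c
∈-choices []       = [] , here refl , ≈nil
∈-choices (m ∷ ms) with find m | ∈-choices ms
... | u , u∈ , e | c , c∈ , f = u ∷ c , Any-concatMap⁺ _ u∈ (∈-map⁺ _ c∈) , ≈cons e f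

prod-⊆T : ∀ {M N T Us} → All (_∈T M) T → All (All (_∈T N)) Us → All (_∈T app M N) (prod T Us)
prod-⊆T AT AUs = Allₚ.concat⁺ (Allₚ.map⁺ (All.map (λ d → Allₚ.map⁺ (All.map (T-app d) (choices-All AUs))) AT))

∈S-prod : ∀ {t us T Us} → t ∈S T → Pointwise _∈S_ us Us → rapp t us ∈S prod T Us
∈S-prod t∈T us∈Us with find t∈T | ∈-choices us∈Us
... | t' , t'∈ , e | c , c∈ , f =
  Any-concatMap⁺ _ t'∈ (∈S-resp-≈ (≈app (≈-sym e) (≈ᴮ-sym f)) (∈⇒∈S (∈-map⁺ _ c∈)))

-- σ replaces the variable x by N and lowers the variables above x, as lsub
-- does; the two booleans are the tests made by lsubVar.
substAt : Bool → Bool → ℕ → Tm → Tm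
substAt true  _     y N = N
substAt false true  y N = var y
substAt false false y N = var (pred y)

SubstAt : (ℕ → Tm) → ℕ → Tm → Set
SubstAt σ x N = ∀ y → σ y ≡ substAt (y ≡ᵇ x) (y <ᵇ x) y N

SubstAt-sub0 : ∀ N → SubstAt (sub0 N) zero N
SubstAt-sub0 N zero    = refl
SubstAt-sub0 N (suc y) = refl

SubstAt-exts : ∀ {σ x N} → SubstAt σ x N → SubstAt (exts σ) (suc x) (renV suc N)
SubstAt-exts {x = zero}  σ≡ zero          = refl
SubstAt-exts {x = suc x} σ≡ zero          = refl
SubstAt-exts {x = zero}  σ≡ (suc zero)    rewrite σ≡ zero = refl
SubstAt-exts {x = suc x} σ≡ (suc zero)    rewrite σ≡ zero = refl
SubstAt-exts {x = x} {N} σ≡ (suc (suc y)) rewrite σ≡ (suc y) = lift (suc y ≡ᵇ x) (suc y <ᵇ x)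
  where
  lift : ∀ b b' → renV suc (substAt b b' (suc y) N) ≡ substAt b b' (suc (suc y)) (renV suc N)
  lift true  _     = refl
  lift false true  = refl
  lift false false = refl

SubstAt-renN : ∀ {σ x N} → SubstAt σ x N → SubstAt (λ k → renN suc (σ k)) x (renN suc N)
SubstAt-renN {x = x} {N} σ≡ y rewrite σ≡ y = lift (y ≡ᵇ x) (y <ᵇ x)
  where
  lift : ∀ b b' → renN suc (substAt b b' y N) ≡ substAt b b' y (renN suc N)
  lift true  _     = refl
  lift false true  = refl
  lift false false = refl

lsubVar-⊆T : ∀ {N} y x B → All (_∈T N) B → All (_∈T substAt (y ≡ᵇ x) (y <ᵇ x) y N) (lsubVar y x B)
lsubVar-⊆T y x [] [] with y ≡ᵇ x | y <ᵇ x
... | true  | _     = []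
... | false | true  = T-var y ∷ []
... | false | false = T-var (pred y) ∷ []
lsubVar-⊆T y x (v ∷ []) (d ∷ []) with y ≡ᵇ x | y <ᵇ x
... | true  | _     = d ∷ []
... | false | true  = []
... | false | false = []
lsubVar-⊆T y x (v ∷ w ∷ B) _ with y ≡ᵇ x | y <ᵇ x
... | true  | _     = []
... | false | true  = []
... | false | false = []

mutual
  lsub-⊆T : ∀ {t M} → t ∈T M → ∀ {σ x N B} → SubstAt σ x N → All (_∈T N) B →
            All (_∈T sub σ M) (lsub t x B)
  lsub-⊆T (T-var y) {x = x} {B = B} σ≡ AB rewrite σ≡ y = lsubVar-⊆T y x B AB
  lsub-⊆T (T-lam d)    σ≡ AB = Allₚ.map⁺ (All.map T-lam (lsub-⊆T d (SubstAt-exts σ≡) (All-∈T-renV suc AB)))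
  lsub-⊆T (T-mu β d)   σ≡ AB = Allₚ.map⁺ (All.map (T-mu β) (lsub-⊆T d (SubstAt-renN σ≡) (All-∈T-renN suc AB)))
  lsub-⊆T (T-app {us = us} d ds) σ≡ AB = Allₚ.concat⁺ (Allₚ.map⁺ (All.map
    (λ { {[]} _ → [] ; {_ ∷ _} (a ∷ as) → prod-⊆T (lsub-⊆T d σ≡ a) (lsubs-⊆T ds σ≡ as) })
    (wc-All (suc (length us)) AB)))

  lsubs-⊆T : ∀ {vs M} → All (_∈T M) vs → ∀ {σ x N Bs} → SubstAt σ x N → All (All (_∈T N)) Bs →
             All (All (_∈T sub σ M)) (lsubs vs x Bs)
  lsubs-⊆T []       σ≡ _        = []
  lsubs-⊆T (d ∷ ds) σ≡ []       = []
  lsubs-⊆T (d ∷ ds) σ≡ (a ∷ as) = lsub-⊆T d σ≡ a ∷ lsubs-⊆T ds σ≡ as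

lsubVar-complete : ∀ {N s'} y x b b' → (y ≡ᵇ x) ≡ b → (y <ᵇ x) ≡ b' → s' ∈T substAt b b' y N →
                   ∃ λ B → All (_∈T N) B × s' ∈S lsubVar y x B
lsubVar-complete {s' = s'} y x true  b' y≡x _ d rewrite y≡x = s' ∷ [] , d ∷ [] , here ≈-refl
lsubVar-complete y x false true  y≡x y<x (T-var _) rewrite y≡x | y<x = [] , [] , here ≈-refl
lsubVar-complete y x false false y≡x y<x (T-var _) rewrite y≡x | y<x = [] , [] , here ≈-refl

mutual
  lsub-complete : ∀ M {σ x N s'} → SubstAt σ x N → s' ∈T sub σ M →
                  ∃₂ λ t B → t ∈T M × All (_∈T N) B × s' ∈S lsub t x B
  lsub-complete (var y) {x = x} {s' = s'} σ≡ d
    with B , AB , m ← lsubVar-complete y x (y ≡ᵇ x) (y <ᵇ x) refl refl (subst (s' ∈T_) (σ≡ y) d)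
    = rvar y , B , T-var y , AB , m
  lsub-complete (lam M) {N = N} σ≡ (T-lam d)
    with t , _ , dt , AB′ , m ← lsub-complete M (SubstAt-exts σ≡) d
    with B , AB , refl ← All-∈T-renV⁻ suc N AB′
    = rlam t , B , T-lam dt , AB , ∈S-map⁺ ≈lam m
  lsub-complete (mu β M) {N = N} σ≡ (T-mu _ d)
    with t , _ , dt , AB′ , m ← lsub-complete M (SubstAt-renN σ≡) d
    with B , AB , refl ← All-∈T-renN⁻ suc N AB′
    = rmu β t , B , T-mu β dt , AB , ∈S-map⁺ (≈mu β) m
  lsub-complete (app M P) σ≡ (T-app d ds)
    with t , B₀ , dt , AB₀ , m ← lsub-complete M σ≡ d
    with vs , Bs , dvs , ABs , len , ms ← lsubs-complete P σ≡ ds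
    = rapp t vs , B₀ ++ concat Bs , T-app dt dvs , Allₚ.++⁺ AB₀ (Allₚ.concat⁺ ABs) ,
      Any-concatMap⁺ _ (∈-wc-split B₀ Bs len) (∈S-prod m ms)

  lsubs-complete : ∀ M {σ x N us'} → SubstAt σ x N → All (_∈T sub σ M) us' →
                   ∃₂ λ vs Bs → All (_∈T M) vs × All (All (_∈T N)) Bs ×
                     length Bs ≡ length vs × Pointwise _∈S_ us' (lsubs vs x Bs)
  lsubs-complete M σ≡ []       = [] , [] , [] , [] , refl , []
  lsubs-complete M σ≡ (d ∷ ds)
    with t , B , dt , AB , m ← lsub-complete M σ≡ d
    with vs , Bs , dvs , ABs , len , ms ← lsubs-complete M σ≡ ds
    = t ∷ vs , B ∷ Bs , dt ∷ dvs , AB ∷ ABs , cong suc len , m ∷ ms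

mutual
  na-⊆T : ∀ {t M} → t ∈T M → ∀ {α N B} → All (_∈T N) B → All (_∈T napp M α N) (na t α B)
  na-⊆T (T-var x) {B = []}    _  = T-var x ∷ []
  na-⊆T (T-var x) {B = _ ∷ _} _  = []
  na-⊆T (T-lam d)          AB = Allₚ.map⁺ (All.map T-lam (na-⊆T d (All-∈T-renV suc AB)))
  na-⊆T (T-mu γ d)         AB = naMu-⊆T γ d (All-∈T-renN suc AB)
  na-⊆T (T-app {us = us} d ds) AB = Allₚ.concat⁺ (Allₚ.map⁺ (All.map
    (λ { {[]} _ → [] ; {_ ∷ _} (a ∷ as) → prod-⊆T (na-⊆T d a) (nas-⊆T ds as) })
    (wc-All (suc (length us)) AB)))

  nas-⊆T : ∀ {vs M} → All (_∈T M) vs → ∀ {α N Bs} → All (All (_∈T N)) Bs →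
           All (All (_∈T napp M α N)) (nas vs α Bs)
  nas-⊆T []       _        = []
  nas-⊆T (d ∷ ds) []       = []
  nas-⊆T (d ∷ ds) (a ∷ as) = na-⊆T d a ∷ nas-⊆T ds as

  naMu-⊆T : ∀ {t M} γ → t ∈T M → ∀ {α N B} → All (_∈T N) B →
            All (_∈T mu γ (nappNamed γ M α N)) (naMu γ t α B)
  naMu-⊆T γ d {α} AB with γ ≡ᵇ α
  ... | false = Allₚ.map⁺ (All.map (T-mu γ) (na-⊆T d AB))
  ... | true  = Allₚ.concat⁺ (Allₚ.map⁺ (All.map
    (λ { {_ ∷ _ ∷ []} (a ∷ b ∷ []) → Allₚ.map⁺ (All.map (λ e → T-mu γ (T-app e b)) (na-⊆T d a))
       ; {[]} _ → [] ; {_ ∷ []} _ → [] ; {_ ∷ _ ∷ _ ∷ _} _ → [] })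
    (wc-All 2 AB)))

mutual
  na-complete : ∀ M {α N s'} → s' ∈T napp M α N →
                ∃₂ λ t B → t ∈T M × All (_∈T N) B × s' ∈S na t α B
  na-complete (var x) (T-var _) = rvar x , [] , T-var x , [] , here ≈-refl
  na-complete (lam M) {N = N} (T-lam d)
    with t , _ , dt , AB′ , m ← na-complete M d
    with B , AB , refl ← All-∈T-renV⁻ suc N AB′
    = rlam t , B , T-lam dt , AB , ∈S-map⁺ ≈lam m
  na-complete (mu γ M) {N = N} d
    with t , _ , dt , AB′ , m ← naMu-complete γ M d
    with B , AB , refl ← All-∈T-renN⁻ suc N AB′
    = rmu γ t , B , T-mu γ dt , AB , m
  na-complete (app M P) (T-app d ds)
    with t , B₀ , dt , AB₀ , m ← na-complete M d
    with vs , Bs , dvs , ABs , len , ms ← nas-complete P ds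
    = rapp t vs , B₀ ++ concat Bs , T-app dt dvs , Allₚ.++⁺ AB₀ (Allₚ.concat⁺ ABs) ,
      Any-concatMap⁺ _ (∈-wc-split B₀ Bs len) (∈S-prod m ms)

  nas-complete : ∀ M {α N us'} → All (_∈T napp M α N) us' →
                 ∃₂ λ vs Bs → All (_∈T M) vs × All (All (_∈T N)) Bs ×
                   length Bs ≡ length vs × Pointwise _∈S_ us' (nas vs α Bs)
  nas-complete M []       = [] , [] , [] , [] , refl , []
  nas-complete M (d ∷ ds)
    with t , B , dt , AB , m ← na-complete M d
    with vs , Bs , dvs , ABs , len , ms ← nas-complete M ds
    = t ∷ vs , B ∷ Bs , dt ∷ dvs , AB ∷ ABs , cong suc len , m ∷ ms

  naMu-complete : ∀ γ M {α N s'} → s' ∈T mu γ (nappNamed γ M α N) →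
                  ∃₂ λ t B → t ∈T M × All (_∈T N) B × s' ∈S naMu γ t α B
  naMu-complete γ M {α} d = naMu-complete′ γ M α (γ ≡ᵇ α) refl d

  naMu-complete′ : ∀ γ M α b → (γ ≡ᵇ α) ≡ b → ∀ {N s'} →
                   s' ∈T mu γ (if b then app (napp M α N) N else napp M α N) →
                   ∃₂ λ t B → t ∈T M × All (_∈T N) B × s' ∈S naMu γ t α B
  naMu-complete′ γ M α false γ≢α (T-mu _ d)
    with t , B , dt , AB , m ← na-complete M d
    rewrite γ≢α = t , B , dt , AB , ∈S-map⁺ (≈mu γ) m
  naMu-complete′ γ M α true γ≡α (T-mu _ (T-app {us = us} d ds))
    with t , B₁ , dt , AB , m ← na-complete M d
    rewrite γ≡α =
    t , B₁ ++ us , dt , Allₚ.++⁺ AB ds ,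
    Any-concatMap⁺ _ (subst (λ C → (B₁ ∷ us ∷ []) ∈ wc 2 (B₁ ++ C)) (++-identityʳ us) (∈-wc-concat (B₁ ∷ us ∷ [])))
      (∈S-map⁺ (λ e → ≈mu γ (≈app e ≈ᴮ-refl)) m)

lamContext : Context rlam
lamContext = record { cong-≈ = ≈lam ; injective-≈ = λ { (≈lam e) → e } ; reduce = lam-r }

muContext : ∀ β → Context (rmu β)
muContext β = record { cong-≈ = ≈mu β ; injective-≈ = λ { (≈mu _ e) → e } ; reduce = mu-r β }

appLContext : ∀ B → Context (λ u → rapp u B)
appLContext B = record
  { cong-≈ = λ e → ≈app e ≈ᴮ-refl ; injective-≈ = λ { (≈app e _) → e } ; reduce = appL-r B }

appRContext : ∀ t vs us → Context (λ w → rapp t (vs ++ w ∷ us))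
appRContext t vs us = record
  { cong-≈      = λ e → ≈app ≈-refl (middle-cong-≈ᴮ vs us e)
  ; injective-≈ = λ { (≈app _ f) → middle-cancel-≈ᴮ vs us f }
  ; reduce      = appR-r t vs us
  }

Sim₁-→b : ∀ {M N} → M →b N → Sim₁ M N
Sim₁-→b (β-rule M N) _ (T-app (T-lam {t} d) ds) =
  _ , lsub-⊆T d (SubstAt-sub0 N) ds , →r⇒↠r (β-r t _)
Sim₁-→b (μ-rule β M N) _ (T-app (T-mu {t} _ d) ds) =
  _ , naMu-⊆T β d (All-∈T-renN suc ds) , →r⇒↠r (μ-r β t _)
Sim₁-→b (ρ-rule a e M) _ (T-mu _ (T-mu {t} _ d)) =
  _ , T-mu (ρren a e) (∈T-renN (ρren a) d) ∷ [] , →r⇒↠r (ρ-r a e t)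

Sim₂-→b : ∀ {M N} → M →b N → Sim₂ M N
Sim₂-→b (β-rule M N) _ d
  with t , B , dt , AB , m ← lsub-complete M (SubstAt-sub0 N) d
  = rapp (rlam t) B , _ , T-app (T-lam dt) AB , lsub-⊆T dt (SubstAt-sub0 N) AB ,
    ↠r-respʳ-≃ (→r⇒↠r (β-r t B)) (∈S⇒∷-≃ m)
Sim₂-→b (μ-rule β M N) _ d
  with t , _ , dt , AB′ , m ← naMu-complete β M d
  with B , AB , refl ← All-∈T-renN⁻ suc N AB′
  = rapp (rmu β t) B , _ , T-app (T-mu β dt) AB , naMu-⊆T β dt AB′ ,
    ↠r-respʳ-≃ (→r⇒↠r (μ-r β t B)) (∈S⇒∷-≃ m)
Sim₂-→b (ρ-rule a e M) _ (T-mu _ d)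
  with t , dt , refl ← ∈T-renN⁻ (ρren a) M d
  = rmu a (rmu e t) , [] , T-mu a (T-mu e dt) , [] , →r⇒↠r (ρ-r a e t)

map-Sim₁ : ∀ {f M N N'} → Context f → (∀ {u} → u ∈T N → f u ∈T N') → Sim₁ M N →
           ∀ {t} → t ∈T M → ∃ λ T → T ⊆T N' × [ f t ] ↠r T
map-Sim₁ {f} C f∈ h₁ d with T , A , D ← h₁ _ d = map f T , Allₚ.map⁺ (All.map f∈ A) , ↠r-map C D

map-Sim₂ : ∀ {f M N N'} → Context f → (∀ {u} → u ∈T N → f u ∈T N') → Sim₂ M N →
           ∀ {t'} → t' ∈T N → ∃₂ λ s T → s ∈T M × T ⊆T N' × [ f s ] ↠r (f t' ∷ T)
map-Sim₂ {f} C f∈ h₂ d with s , T , ds , A , D ← h₂ _ d =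
  s , map f T , ds , Allₚ.map⁺ (All.map f∈ A) , ↠r-map C D

Sim-lam : ∀ {M N} → Sim₁ M N × Sim₂ M N → Sim₁ (lam M) (lam N) × Sim₂ (lam M) (lam N)
Sim-lam (h₁ , h₂) =
  (λ { _ (T-lam d) → map-Sim₁ lamContext T-lam h₁ d }) ,
  (λ { _ (T-lam d) → let s , T , ds , A , D = map-Sim₂ lamContext T-lam h₂ d in rlam s , T , T-lam ds , A , D })

Sim-mu : ∀ {M N} β → Sim₁ M N × Sim₂ M N → Sim₁ (mu β M) (mu β N) × Sim₂ (mu β M) (mu β N)
Sim-mu β (h₁ , h₂) =
  (λ { _ (T-mu _ d) → map-Sim₁ (muContext β) (T-mu β) h₁ d }) ,
  (λ { _ (T-mu _ d) → let s , T , ds , A , D = map-Sim₂ (muContext β) (T-mu β) h₂ d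
                      in rmu β s , T , T-mu β ds , A , D })

Sim-appL : ∀ {M N} P → Sim₁ M N × Sim₂ M N → Sim₁ (app M P) (app N P) × Sim₂ (app M P) (app N P)
Sim-appL P (h₁ , h₂) =
  (λ { _ (T-app d ds) → map-Sim₁ (appLContext _) (λ e → T-app e ds) h₁ d }) ,
  (λ { _ (T-app d ds) → let s , T , ds′ , A , D = map-Sim₂ (appLContext _) (λ e → T-app e ds) h₂ d
                        in rapp s _ , T , T-app ds′ ds , A , D })

rapp-++-∷ : ∀ t vs w us → rapp t ((vs ++ [ w ]) ++ us) ≡ rapp t (vs ++ w ∷ us)
rapp-++-∷ t vs w us = cong (rapp t) (++-assoc vs [ w ] us)

-- vs are the arguments already reduced.
mutual
  ReducesInto-args : ∀ {P N t} → t ∈T P → ∀ vs → All (_∈T N) vs → ∀ us →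
                     All (λ u → ReducesInto (_∈T N) [ u ]) us →
                     ReducesInto (_∈T app P N) [ rapp t (vs ++ us) ]
  ReducesInto-args dt vs dvs [] [] = _ , T-app dt (Allₚ.++⁺ dvs []) ∷ [] , ↠refl ≃-refl
  ReducesInto-args {t = t} dt vs dvs (u ∷ us) ((_ , AU , D) ∷ rs) =
    ReducesInto-↠r ∈T-resp-≈ (↠r-map (appRContext t vs us) D) (ReducesInto-map-args dt vs dvs us rs AU)

  ReducesInto-map-args : ∀ {P N t} → t ∈T P → ∀ vs → All (_∈T N) vs → ∀ us →
                         All (λ u → ReducesInto (_∈T N) [ u ]) us → ∀ {W} → All (_∈T N) W →
                         ReducesInto (_∈T app P N) (map (λ w → rapp t (vs ++ w ∷ us)) W)
  ReducesInto-map-args {P} {N} {t} dt vs dvs us rs AW =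
    ReducesInto-sum ∈T-resp-≈ (Allₚ.map⁺ (All.map (λ {w} dw →
      subst (λ a → ReducesInto (_∈T app P N) [ a ]) (rapp-++-∷ t vs w us)
        (ReducesInto-args dt (vs ++ [ w ]) (Allₚ.++⁺ dvs (dw ∷ [])) us rs)) AW))

-- The reduct of s is u' plus junk T₁; by (1) the junk also reduces into the
-- expansion, and ↠r-∷-ReducesInto does so while keeping the term built from u'.
Sim₂-args : ∀ {P M N t} → t ∈T P → Sim₁ M N → Sim₂ M N → ∀ vs → All (_∈T N) vs → ∀ {us'} → All (_∈T N) us' →
            ∃ λ ss → All (_∈T M) ss × ∃ λ T → T ⊆T app P N × [ rapp t (vs ++ ss) ] ↠r (rapp t (vs ++ us') ∷ T)
Sim₂-args dt h₁ h₂ vs dvs [] = [] , [] , [] , [] , ↠refl ≃-refl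
Sim₂-args {t = t} dt h₁ h₂ vs dvs {u' ∷ us'} (du' ∷ dus')
  with s , T₁ , ds , A₁ , D₁ ← h₂ u' du'
  with ss , dss , T₂ , A₂ , D₂ ← Sim₂-args dt h₁ h₂ (vs ++ [ u' ]) (Allₚ.++⁺ dvs (du' ∷ [])) dus'
  with T , AT , D ← ↠r-∷-ReducesInto ∈T-resp-≈
         (subst₂ (λ a b → [ a ] ↠r (b ∷ T₂)) (rapp-++-∷ t vs u' ss) (rapp-++-∷ t vs u' us') D₂)
         (T-app dt (Allₚ.++⁺ dvs (du' ∷ dus')) ∷ A₂)
         (ReducesInto-map-args dt vs dvs ss (All.map (h₁ _) dss) A₁)
  = s ∷ ss , ds ∷ dss , T , AT , ↠r-trans (↠r-map (appRContext t vs ss) D₁) D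

Sim-appR : ∀ {M N} P → Sim₁ M N × Sim₂ M N → Sim₁ (app P M) (app P N) × Sim₂ (app P M) (app P N)
Sim-appR P (h₁ , h₂) =
  (λ { _ (T-app {us = us} d ds) → ReducesInto-args d [] [] us (All.map (h₁ _) ds) }) ,
  (λ { _ (T-app d ds) → let ss , dss , T , A , D = Sim₂-args d h₁ h₂ [] [] ds in rapp _ ss , T , T-app d dss , A , D })

Sim-→b : ∀ {M N} → M →b N → Sim₁ M N × Sim₂ M N
Sim-→b r = Sim₁-→b r , Sim₂-→b r

Sim-⟶ : ∀ {M N} → M ⟶ N → Sim₁ M N × Sim₂ M N
Sim-⟶ (base r)       = Sim-→b r
Sim-⟶ (ctx-lam r)    = Sim-lam (Sim-⟶ r)
Sim-⟶ (ctx-appL P r) = Sim-appL P (Sim-⟶ r)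
Sim-⟶ (ctx-appR P r) = Sim-appR P (Sim-⟶ r)
Sim-⟶ (ctx-mu β r)   = Sim-mu β (Sim-⟶ r)

proposition3p4 : ((M N : Tm) → M →b N → Sim₁ M N × Sim₂ M N)
                 × ((M N : Tm) → M ⟶ N → Sim₁ M N × Sim₂ M N)
proposition3p4 = (λ _ _ → Sim-→b) , (λ _ _ → Sim-⟶)
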